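{- Let $m$, $n$ be non-negative integers and $r$ any integer. Then \[ \begin{split} \sum_{k=1}^n k^mw_{k + r}^*&=-w_r^*\,\delta_{m,0}+\left(n^m + q\sum_{s = 1}^m \binom ms\frac{n^{m - s} }{q^{s + 1} }\sum_{j = 1}^s A(s,j)u_{j + s} \right)w_{n + r}^*\\ &\quad -\left(\frac{n^m }{q} + \sum_{s = 1}^m \binom ms\frac{n^{m - s} }{q^{s + 1} }\sum_{j = 1}^s A(s,j)u_{j + s + 1} \right)w_{n + r + 1}^* + \frac{1}{q^{m + 1} }\sum_{j = 0}^m A(m,j)w_{j + m + 1 + r}^* . \end{split} \]
   Context: Let $a,b,q$ be complex numbers with $q\ne0$. Define $(w^*_j)$ by $w^*_0=a$, $w^*_1=b$, $w^*_j=w^*_{j-1}-qw^*_{j-2}$ for $j\ge2$, extended to negative indices by $w^*_{ -j}=(w^*_{ -j+1}-w^*_{ -j+2})/q$. Let $(u_j)$ be the sequence obtained with $(a,b)=(0,1)$. $\delta_{m,0}$ is the Kronecker delta. The Eulerian numbers are $A(i,j)=\sum_{t=0}^j(-1)^t\binom{i+1}{t}(j-t)^i$ for non-negative integers $i,j$, with $0^0=1$. Empty sums are $0$. -}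

module Defs where

open import Level using (Level)
open import Algebra.Bundles using (CommutativeRing)
open import Data.Nat as ℕ using (ℕ; zero; suc)
open import Data.Nat.Combinatorics using (_C_)
open import Data.Integer as ℤ using (ℤ; +_; -[1+_])
open import Data.Product using (_×_; _,_; proj₁)

-- Eulerian numbers A(i,j) = Σ_{t=0}^{j} (-1)^t C(i+1,t) (j-t)^i  (as integers; ℕ's 0^0 = 1)
ℤsum≤ : ℕ → (ℕ → ℤ) → ℤ
ℤsum≤ zero f = f zero
ℤsum≤ (suc j) f = ℤsum≤ j f ℤ.+ f (suc j)

sign : ℕ → ℤ
sign zero = ℤ.+ 1
sign (suc t) = ℤ.- sign t

Eulerian : ℕ → ℕ → ℤ
Eulerian i j = ℤsum≤ j (λ t → sign t ℤ.* (+ (suc i C t)) ℤ.* (+ ((j ℕ.∸ t) ℕ.^ i)))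

module _ {c ℓ : Level} (R : CommutativeRing c ℓ) where
  open CommutativeRing R

  ι : ℕ → Carrier
  ι zero = 0#
  ι (suc n) = 1# + ι n

  ιℤ : ℤ → Carrier
  ιℤ (+ n) = ι n
  ιℤ -[1+ n ] = - ι (suc n)

  pow : Carrier → ℕ → Carrier
  pow x zero = 1#
  pow x (suc n) = x * pow x n

  Σ< : ℕ → (ℕ → Carrier) → Carrier
  Σ< zero f = 0#
  Σ< (suc n) f = Σ< n f + f n

  Σ1 : ℕ → (ℕ → Carrier) → Carrier
  Σ1 n f = Σ< n (λ i → f (suc i))

  Σ0 : ℕ → (ℕ → Carrier) → Carrier
  Σ0 n f = Σ< (suc n) f

  δ0 : ℕ → Carrier
  δ0 zero = 1#
  δ0 (suc _) = 0#

  -- Horadam-type sequence w*_j (j ∈ ℤ) with w*_0 = a, w*_1 = b,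
  -- w*_j = w*_{j-1} - q w*_{j-2}, and w*_{-j} = (w*_{-j+1} - w*_{-j+2}) / q,
  -- where qinv is the inverse of q.
  module Seq (q qinv a b : Carrier) where
    -- wPos n = (w*_n , w*_{n+1})
    wPos : ℕ → Carrier × Carrier
    wPos zero = a , b
    wPos (suc n) with wPos n
    ... | x , y = y , (y - q * x)

    -- wNeg n = (w*_{-(n+1)} , w*_{-n})
    wNeg : ℕ → Carrier × Carrier
    wNeg zero = (a - b) * qinv , a
    wNeg (suc n) with wNeg n
    ... | x , y = (x - y) * qinv , x

    w : ℤ → Carrier
    w (+ n) = proj₁ (wPos n)
    w -[1+ n ] = proj₁ (wNeg n)

  wStar : (q qinv a b : Carrier) → ℤ → Carrier
  wStar q qinv a b = Seq.w q qinv a b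

  uSeq : (q qinv : Carrier) → ℤ → Carrier
  uSeq q qinv = Seq.w q qinv 0# 1#

{-# OPTIONS --safe #-}
module Submission where

-- Put v_k = w*_(k+r). The recurrence reads q v_k = v_(k+1) - v_(k+2), so pairing v with a
-- finitely supported coefficient sequence c turns multiplication by q into the operator
-- c ↦ shift (∇ c), where ∇ c = c - shift c is the backward difference. Hence
-- q^(m+1) Σ_(k≤n) k^m v_k is the pairing of v with shift^(m+1) ∇^(m+1) T, where T is the
-- sequence k^m cut off after k = n. Writing T = G_m - shift^n H with G_s = (J^s)_J and
-- H_i = (n + i)^m - n^m δ_(i,0) expanded binomially in i, everything reduces to the sequences
-- ∇^(s+1) G_s, which are the Eulerian numbers A(s, ·) and vanish beyond s. The terms pushed
-- past n are finally rewritten in v_n and v_(n+1) by v_(K+1+n) = u_(K+1) v_(n+1) - q u_K v_n.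

open import Defs
open import Level using (Level; _⊔_)
open import Function using (_∘_)
open import Algebra.Bundles using (CommutativeRing)
import Algebra.Solver.Ring as RingSolver
import Algebra.Solver.Ring.AlmostCommutativeRing as ACR
open import Data.Nat using (ℕ; zero; suc; _≤_; _<_; z≤n; s≤s; s≤s⁻¹)
import Data.Nat as ℕ
import Data.Nat.Properties as ℕₚ
open import Data.Nat.Combinatorics using (_C_; k>n⇒nCk≡0; nCk+nC[k+1]≡[n+1]C[k+1]; nCn≡1)
open import Data.Nat.GeneralisedArithmetic using (fold; fold-+)
open import Data.Nat.Tactic.RingSolver using (solve-∀)
open import Data.Integer using (ℤ; +_; -[1+_])
import Data.Integer as ℤ
import Data.Integer.Properties as ℤₚ
open import Data.Fin using (Fin; toℕ)
import Data.Fin.Properties as Finₚ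
open import Data.Vec.Functional using (init; last)
open import Data.Product using (_×_; _,_; proj₁; proj₂)
open import Data.Sum using (inj₁; inj₂)
open import Data.Maybe using (Maybe; just; nothing)
open import Relation.Nullary using (yes; no)
open import Relation.Binary.Bundles using (Setoid)
open import Relation.Binary.PropositionalEquality as ≡ using (_≡_)
import Relation.Binary.Reasoning.Setoid as SetoidReasoning

module HoradamPowerSums {c ℓ : Level} (R : CommutativeRing c ℓ) where
  open CommutativeRing R hiding (zero)
  open import Algebra.Properties.Ring ring
  open import Algebra.Properties.Semiring.Mult semiring using () renaming (_×_ to _·_)
  open import Algebra.Properties.CommutativeSemiring.Exp commutativeSemiring using (_^_; ^-congˡ)
  open import Algebra.Properties.CommutativeSemiring.Binomial commutativeSemiring
    using (binomialTerm) renaming (theorem to binomial-theorem)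
  open import Algebra.Properties.Monoid.Sum +-monoid using (sum; sum-init-last; sum-cong-≗)
  open SetoidReasoning setoid

  ι-+ : ∀ m n → ι R (m ℕ.+ n) ≈ ι R m + ι R n
  ι-+ zero    n = sym (+-identityˡ _)
  ι-+ (suc m) n = trans (+-congˡ (ι-+ m n)) (sym (+-assoc _ _ _))

  ι-* : ∀ m n → ι R (m ℕ.* n) ≈ ι R m * ι R n
  ι-* zero    n = sym (zeroˡ _)
  ι-* (suc m) n = begin
    ι R (n ℕ.+ m ℕ.* n)        ≈⟨ ι-+ n (m ℕ.* n) ⟩
    ι R n + ι R (m ℕ.* n)      ≈⟨ +-cong (sym (*-identityˡ _)) (ι-* m n) ⟩
    1# * ι R n + ι R m * ι R n ≈⟨ distribʳ _ _ _ ⟨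
    (1# + ι R m) * ι R n       ∎

  ι-^ : ∀ m n → ι R (m ℕ.^ n) ≈ pow R (ι R m) n
  ι-^ m zero    = +-identityʳ 1#
  ι-^ m (suc n) = trans (ι-* m (m ℕ.^ n)) (*-congˡ (ι-^ m n))

  ι-C : ∀ {n k} → n < k → ι R (n C k) ≈ 0#
  ι-C n<k = reflexive (≡.cong (ι R) (k>n⇒nCk≡0 n<k))

  ι-Pascal : ∀ n k → ι R (n C k) + ι R (n C suc k) ≈ ι R (suc n C suc k)
  ι-Pascal n k = trans (sym (ι-+ (n C k) (n C suc k))) (reflexive (≡.cong (ι R) (nCk+nC[k+1]≡[n+1]C[k+1] n k)))

  [1+x]-[1+y]≈x-y : ∀ x y → (1# + x) - (1# + y) ≈ x - y
  [1+x]-[1+y]≈x-y x y = begin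
    (1# + x) - (1# + y)     ≈⟨ +-cong (+-comm x 1#) (-‿+-comm 1# y) ⟨
    (x + 1#) + (- 1# - y)   ≈⟨ +-assoc x 1# _ ⟩
    x + (1# + (- 1# - y))   ≈⟨ +-congˡ (+-assoc 1# (- 1#) (- y)) ⟨
    x + ((1# - 1#) - y)     ≈⟨ +-congˡ (+-congʳ (-‿inverseʳ 1#)) ⟩
    x + (0# - y)            ≈⟨ +-congˡ (+-identityˡ (- y)) ⟩
    x - y                   ∎

  ιℤ-⊖ : ∀ m n → ιℤ R (m ℤ.⊖ n) ≈ ι R m - ι R n
  ιℤ-⊖ m       zero    = trans (sym (+-identityʳ _)) (+-congˡ (sym -0#≈0#))
  ιℤ-⊖ zero    (suc n) = sym (+-identityˡ _)
  ιℤ-⊖ (suc m) (suc n) = begin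
    ιℤ R (suc m ℤ.⊖ suc n)        ≡⟨ ≡.cong (ιℤ R) (ℤₚ.[1+m]⊖[1+n]≡m⊖n m n) ⟩
    ιℤ R (m ℤ.⊖ n)                ≈⟨ ιℤ-⊖ m n ⟩
    ι R m - ι R n                 ≈⟨ [1+x]-[1+y]≈x-y (ι R m) (ι R n) ⟨
    (1# + ι R m) - (1# + ι R n)   ∎

  ιℤ-+ : ∀ x y → ιℤ R (x ℤ.+ y) ≈ ιℤ R x + ιℤ R y
  ιℤ-+ (+ m)    (+ n)    = ι-+ m n
  ιℤ-+ (+ m)    -[1+ n ] = ιℤ-⊖ m (suc n)
  ιℤ-+ -[1+ m ] (+ n)    = trans (ιℤ-⊖ n (suc m)) (+-comm _ _)
  ιℤ-+ -[1+ m ] -[1+ n ] = begin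
    - (1# + ι R (suc (m ℕ.+ n)))    ≈⟨ -‿cong (+-congˡ (ι-+ (suc m) n)) ⟩
    - (1# + (ι R (suc m) + ι R n))  ≈⟨ -‿cong (+-congˡ (+-comm _ _)) ⟩
    - (1# + (ι R n + ι R (suc m)))  ≈⟨ -‿cong (+-assoc _ _ _) ⟨
    - (ι R (suc n) + ι R (suc m))   ≈⟨ -‿cong (+-comm _ _) ⟩
    - (ι R (suc m) + ι R (suc n))   ≈⟨ -‿+-comm _ _ ⟨
    - ι R (suc m) - ι R (suc n)     ∎

  ιℤ-neg : ∀ x → ιℤ R (ℤ.- x) ≈ - ιℤ R x
  ιℤ-neg (+ zero)  = sym -0#≈0#
  ιℤ-neg (+ suc n) = refl
  ιℤ-neg -[1+ n ]  = sym (-‿involutive _)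

  ιℤ-*-+ : ∀ m y → ιℤ R (+ m ℤ.* y) ≈ ι R m * ιℤ R y
  ιℤ-*-+ m (+ n)    = trans (reflexive (≡.cong (ιℤ R) (≡.sym (ℤₚ.pos-* m n)))) (ι-* m n)
  ιℤ-*-+ m -[1+ n ] = begin
    ιℤ R (+ m ℤ.* ℤ.- (+ suc n))   ≡⟨ ≡.cong (ιℤ R) (ℤₚ.neg-distribʳ-* (+ m) (+ suc n)) ⟨
    ιℤ R (ℤ.- (+ m ℤ.* + suc n))   ≈⟨ ιℤ-neg (+ m ℤ.* + suc n) ⟩
    - ιℤ R (+ m ℤ.* + suc n)       ≈⟨ -‿cong (ιℤ-*-+ m (+ suc n)) ⟩
    - (ι R m * ι R (suc n))        ≈⟨ -‿distribʳ-* _ _ ⟩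
    ι R m * - ι R (suc n)          ∎

  ιℤ-* : ∀ x y → ιℤ R (x ℤ.* y) ≈ ιℤ R x * ιℤ R y
  ιℤ-* (+ m)    y = ιℤ-*-+ m y
  ιℤ-* -[1+ m ] y = begin
    ιℤ R (ℤ.- (+ suc m) ℤ.* y)   ≡⟨ ≡.cong (ιℤ R) (ℤₚ.neg-distribˡ-* (+ suc m) y) ⟨
    ιℤ R (ℤ.- (+ suc m ℤ.* y))   ≈⟨ ιℤ-neg (+ suc m ℤ.* y) ⟩
    - ιℤ R (+ suc m ℤ.* y)       ≈⟨ -‿cong (ιℤ-*-+ (suc m) y) ⟩
    - (ι R (suc m) * ιℤ R y)     ≈⟨ -‿distribˡ-* _ _ ⟩
    - ι R (suc m) * ιℤ R y       ∎

  private
    ring-with-ℤ : ACR.AlmostCommutativeRing c ℓ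
    ring-with-ℤ = ACR.fromCommutativeRing R

    ιℤ-morphism : ℤ.+-*-rawRing ACR.-Raw-AlmostCommutative⟶ ring-with-ℤ
    ιℤ-morphism = record
      { ⟦_⟧ = ιℤ R ; +-homo = ιℤ-+ ; *-homo = ιℤ-* ; -‿homo = ιℤ-neg
      ; 0-homo = refl ; 1-homo = +-identityʳ 1# }

    ιℤ-≟ : ∀ x y → Maybe (ιℤ R x ≈ ιℤ R y)
    ιℤ-≟ x y with x ℤ.≟ y
    ... | yes ≡.refl = just refl
    ... | no _       = nothing

  open RingSolver ℤ.+-*-rawRing ring-with-ℤ ιℤ-morphism ιℤ-≟

  Σ<-cong-< : ∀ d {f g : ℕ → Carrier} → (∀ i → i < d → f i ≈ g i) → Σ< R d f ≈ Σ< R d g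
  Σ<-cong-< zero    eq = refl
  Σ<-cong-< (suc d) eq = +-cong (Σ<-cong-< d (λ i i<d → eq i (ℕₚ.m<n⇒m<1+n i<d))) (eq d (ℕₚ.n<1+n d))

  Σ<-cong : ∀ d {f g : ℕ → Carrier} → (∀ i → f i ≈ g i) → Σ< R d f ≈ Σ< R d g
  Σ<-cong d eq = Σ<-cong-< d (λ i _ → eq i)

  Σ<-zero : ∀ d → Σ< R d (λ _ → 0#) ≈ 0#
  Σ<-zero zero    = refl
  Σ<-zero (suc d) = trans (+-identityʳ _) (Σ<-zero d)

  Σ<-+ : ∀ d (f g : ℕ → Carrier) → Σ< R d (λ i → f i + g i) ≈ Σ< R d f + Σ< R d g
  Σ<-+ zero    f g = sym (+-identityˡ _)
  Σ<-+ (suc d) f g = trans (+-congʳ (Σ<-+ d f g))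
    (solve 4 (λ a b x y → (a :+ b) :+ (x :+ y) := (a :+ x) :+ (b :+ y)) refl _ _ _ _)

  Σ<-neg : ∀ d (f : ℕ → Carrier) → - Σ< R d f ≈ Σ< R d (λ i → - f i)
  Σ<-neg zero    f = -0#≈0#
  Σ<-neg (suc d) f = trans (sym (-‿+-comm _ _)) (+-congʳ (Σ<-neg d f))

  Σ<-sub : ∀ d (f g : ℕ → Carrier) → Σ< R d (λ i → f i - g i) ≈ Σ< R d f - Σ< R d g
  Σ<-sub d f g = trans (Σ<-+ d f (λ i → - g i)) (+-congˡ (sym (Σ<-neg d g)))

  Σ<-distribˡ : ∀ d a (f : ℕ → Carrier) → a * Σ< R d f ≈ Σ< R d (λ i → a * f i)
  Σ<-distribˡ zero    a f = zeroʳ a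
  Σ<-distribˡ (suc d) a f = trans (distribˡ _ _ _) (+-congʳ (Σ<-distribˡ d a f))

  Σ<-distribʳ : ∀ d a (f : ℕ → Carrier) → Σ< R d f * a ≈ Σ< R d (λ i → f i * a)
  Σ<-distribʳ d a f = trans (*-comm _ _) (trans (Σ<-distribˡ d a f) (Σ<-cong d (λ i → *-comm _ _)))

  Σ<-comm : ∀ d e (f : ℕ → ℕ → Carrier) →
            Σ< R d (λ i → Σ< R e (f i)) ≈ Σ< R e (λ j → Σ< R d (λ i → f i j))
  Σ<-comm zero    e f = sym (Σ<-zero e)
  Σ<-comm (suc d) e f = trans (+-congʳ (Σ<-comm d e f)) (sym (Σ<-+ e _ _))

  Σ<-head : ∀ d (f : ℕ → Carrier) → Σ< R (suc d) f ≈ f 0 + Σ< R d (λ i → f (suc i))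
  Σ<-head zero    f = trans (+-identityˡ _) (sym (+-identityʳ _))
  Σ<-head (suc d) f = trans (+-congʳ (Σ<-head d f)) (+-assoc _ _ _)

  Σ<-pad : ∀ d e (f : ℕ → Carrier) → (∀ i → d ≤ i → f i ≈ 0#) → Σ< R (e ℕ.+ d) f ≈ Σ< R d f
  Σ<-pad d zero    f f≈0 = refl
  Σ<-pad d (suc e) f f≈0 =
    trans (+-congˡ (f≈0 (e ℕ.+ d) (ℕₚ.m≤n+m d e))) (trans (+-identityʳ _) (Σ<-pad d e f f≈0))

  Σ<-linear₂ : ∀ d (f g : ℕ → Carrier) a x y →
               Σ< R d (λ j → f j * x - a * g j * y) ≈ Σ< R d f * x - a * Σ< R d g * y
  Σ<-linear₂ d f g a x y = begin
    Σ< R d (λ j → f j * x - a * g j * y)             ≈⟨ Σ<-sub d _ _ ⟩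
    Σ< R d (λ j → f j * x) - Σ< R d (λ j → a * g j * y)
      ≈⟨ +-cong (Σ<-distribʳ d x f) (-‿cong (Σ<-cong d (λ j → sym (*-assoc a (g j) y)))) ⟨
    Σ< R d f * x - Σ< R d (λ j → a * (g j * y))      ≈⟨ +-congˡ (-‿cong (Σ<-distribˡ d a _)) ⟨
    Σ< R d f * x - a * Σ< R d (λ j → g j * y)        ≈⟨ +-congˡ (-‿cong (*-congˡ (Σ<-distribʳ d y g))) ⟨
    Σ< R d f * x - a * (Σ< R d g * y)                ≈⟨ +-congˡ (-‿cong (*-assoc a _ y)) ⟨
    Σ< R d f * x - a * Σ< R d g * y                  ∎

  Σ<≈sum : ∀ d (f : ℕ → Carrier) → Σ< R d f ≈ sum {d} (f ∘ toℕ)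
  Σ<≈sum zero    f = refl
  Σ<≈sum (suc d) f = begin
    Σ< R d f + f d          ≈⟨ +-cong (Σ<≈sum d f) (reflexive (≡.cong f (≡.sym (Finₚ.toℕ-fromℕ d)))) ⟩
    sum {d} (f ∘ toℕ) + last g ≡⟨ ≡.cong (_+ last g) (sum-cong-≗ {d} (≡.cong f ∘ ≡.sym ∘ Finₚ.toℕ-inject₁)) ⟩
    sum (init g) + last g   ≈⟨ sum-init-last g ⟨
    sum g                   ∎
    where
    g : Fin (suc d) → Carrier
    g = f ∘ toℕ

  pow≡^ : ∀ x n → pow R x n ≡ x ^ n
  pow≡^ x zero    = ≡.refl
  pow≡^ x (suc n) = ≡.cong (x *_) (pow≡^ x n)

  ·≈ι* : ∀ n x → n · x ≈ ι R n * x
  ·≈ι* zero    x = sym (zeroˡ x)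
  ·≈ι* (suc n) x = trans (+-cong (sym (*-identityˡ x)) (·≈ι* n x)) (sym (distribʳ x 1# (ι R n)))

  pow-congˡ : ∀ n {x y} → x ≈ y → pow R x n ≈ pow R y n
  pow-congˡ zero    _   = refl
  pow-congˡ (suc n) x≈y = *-cong x≈y (pow-congˡ n x≈y)

  pow-1# : ∀ n → pow R 1# n ≈ 1#
  pow-1# zero    = refl
  pow-1# (suc n) = trans (*-identityˡ _) (pow-1# n)

  pow-0# : ∀ n → pow R 0# n ≈ δ0 R n
  pow-0# zero    = refl
  pow-0# (suc n) = zeroˡ _

  pow-+ : ∀ x a b → pow R x (a ℕ.+ b) ≈ pow R x a * pow R x b
  pow-+ x zero    b = sym (*-identityˡ _)
  pow-+ x (suc a) b = trans (*-congˡ (pow-+ x a b)) (sym (*-assoc _ _ _))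

  pow-inverse : ∀ {q qinv} → q * qinv ≈ 1# → ∀ p → pow R qinv p * pow R q p ≈ 1#
  pow-inverse qq zero    = *-identityˡ 1#
  pow-inverse {q} {qinv} qq (suc p) = begin
    (qinv * pow R qinv p) * (q * pow R q p)
      ≈⟨ solve 4 (λ a b x y → (a :* b) :* (x :* y) := (x :* a) :* (b :* y)) refl _ _ _ _ ⟩
    (q * qinv) * (pow R qinv p * pow R q p)   ≈⟨ *-cong qq (pow-inverse qq p) ⟩
    1# * 1#                                   ≈⟨ *-identityˡ 1# ⟩
    1#                                        ∎

  binomial : ∀ x y m → pow R (x + y) m ≈ Σ< R (suc m) (λ s → ι R (m C s) * (pow R x (m ℕ.∸ s) * pow R y s))
  binomial x y m = begin
    pow R (x + y) m                       ≡⟨ pow≡^ (x + y) m ⟩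
    (x + y) ^ m                           ≈⟨ ^-congˡ m (+-comm x y) ⟩
    (y + x) ^ m                           ≈⟨ binomial-theorem m y x ⟩
    sum (binomialTerm y x m)              ≈⟨ Σ<≈sum (suc m) _ ⟨
    Σ< R (suc m) (λ s → (m C s) · (y ^ s * x ^ (m ℕ.∸ s)))  ≈⟨ Σ<-cong (suc m) term ⟩
    Σ< R (suc m) (λ s → ι R (m C s) * (pow R x (m ℕ.∸ s) * pow R y s)) ∎
    where
    term : ∀ s → (m C s) · (y ^ s * x ^ (m ℕ.∸ s)) ≈ ι R (m C s) * (pow R x (m ℕ.∸ s) * pow R y s)
    term s = trans (·≈ι* (m C s) _) (*-congˡ (trans (*-comm _ _)
               (reflexive (≡.cong₂ _*_ (≡.sym (pow≡^ x (m ℕ.∸ s))) (≡.sym (pow≡^ y s))))))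

  Coeff : Set c
  Coeff = ℕ → Carrier

  infix 4 _≋_
  _≋_ : Coeff → Coeff → Set ℓ
  f ≋ g = ∀ J → f J ≈ g J

  ≋-setoid : Setoid c ℓ
  ≋-setoid = record
    { Carrier = Coeff
    ; _≈_ = _≋_
    ; isEquivalence = record
      { refl  = λ _ → refl
      ; sym   = λ f≋g J → sym (f≋g J)
      ; trans = λ f≋g g≋h J → trans (f≋g J) (g≋h J) } }

  open Setoid ≋-setoid using ()
    renaming (refl to ≋-refl; sym to ≋-sym; trans to ≋-trans; reflexive to ≋-reflexive)

  infixl 6 _⊕_ _⊖_
  infixr 7 _⊙_

  _⊕_ _⊖_ : Coeff → Coeff → Coeff
  (f ⊕ g) J = f J + g J
  (f ⊖ g) J = f J - g J

  _⊙_ : Carrier → Coeff → Coeff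
  (a ⊙ f) J = a * f J

  0ᶜ : Coeff
  0ᶜ _ = 0#

  Σᶜ : ℕ → (ℕ → Coeff) → Coeff
  Σᶜ d f J = Σ< R d (λ t → f t J)

  shift : Coeff → Coeff
  shift f zero    = 0#
  shift f (suc J) = f J

  ∇ : Coeff → Coeff
  ∇ f = f ⊖ shift f

  shift∇ : Coeff → Coeff
  shift∇ f = shift (∇ f)

  infix 9 _^[_]
  _^[_] : (Coeff → Coeff) → ℕ → Coeff → Coeff
  (F ^[ p ]) f = fold f F p

  ^[]-+ : ∀ F a b f → (F ^[ a ℕ.+ b ]) f ≡ (F ^[ a ]) ((F ^[ b ]) f)
  ^[]-+ F a b f = fold-+ f F a

  record IsLinear (F : Coeff → Coeff) : Set (c ⊔ ℓ) where
    field
      cong   : ∀ {f g} → f ≋ g → F f ≋ F g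
      ⊕-homo : ∀ f g → F (f ⊕ g) ≋ F f ⊕ F g
      ⊙-homo : ∀ a f → F (a ⊙ f) ≋ a ⊙ F f

    0-homo : F 0ᶜ ≋ 0ᶜ
    0-homo J = begin
      F 0ᶜ J        ≈⟨ cong (λ _ → sym (zeroˡ 0#)) J ⟩
      F (0# ⊙ 0ᶜ) J ≈⟨ ⊙-homo 0# 0ᶜ J ⟩
      0# * F 0ᶜ J   ≈⟨ zeroˡ _ ⟩
      0#            ∎

    ⊖-homo : ∀ f g → F (f ⊖ g) ≋ F f ⊖ F g
    ⊖-homo f g J = begin
      F (f ⊖ g) J               ≈⟨ cong (λ J → +-congˡ (sym (-1*x≈-x (g J)))) J ⟩
      F (f ⊕ (- 1#) ⊙ g) J      ≈⟨ ⊕-homo f _ J ⟩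
      F f J + F ((- 1#) ⊙ g) J  ≈⟨ +-congˡ (⊙-homo _ _ J) ⟩
      F f J + (- 1#) * F g J    ≈⟨ +-congˡ (-1*x≈-x _) ⟩
      F f J - F g J             ∎

    Σᶜ-homo : ∀ d f → F (Σᶜ d f) ≋ Σᶜ d (λ t → F (f t))
    Σᶜ-homo zero    f = 0-homo
    Σᶜ-homo (suc d) f J = trans (⊕-homo (Σᶜ d f) (f d) J) (+-congʳ (Σᶜ-homo d f J))

  open IsLinear

  shift-linear : IsLinear shift
  shift-linear = record
    { cong   = λ { f≋g zero → refl ; f≋g (suc J) → f≋g J }
    ; ⊕-homo = λ { f g zero → sym (+-identityʳ 0#) ; f g (suc J) → refl }
    ; ⊙-homo = λ { a f zero → sym (zeroʳ a) ; a f (suc J) → refl } }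

  ∇-linear : IsLinear ∇
  ∇-linear = record
    { cong   = λ f≋g J → +-cong (f≋g J) (-‿cong (cong shift-linear f≋g J))
    ; ⊕-homo = λ f g J → trans (+-congˡ (-‿cong (⊕-homo shift-linear f g J)))
                 (solve 4 (λ a b x y → (a :+ b) :- (x :+ y) := (a :- x) :+ (b :- y)) refl _ _ _ _)
    ; ⊙-homo = λ a f J → trans (+-congˡ (-‿cong (⊙-homo shift-linear a f J)))
                 (solve 3 (λ a x y → a :* x :- a :* y := a :* (x :- y)) refl _ _ _) }

  ∘-linear : ∀ {F G : Coeff → Coeff} → IsLinear F → IsLinear G → IsLinear (F ∘ G)
  ∘-linear {F} {G} LF LG = record
    { cong   = cong LF ∘ cong LG
    ; ⊕-homo = λ f g → ≋-trans (cong LF (⊕-homo LG f g)) (⊕-homo LF (G f) (G g))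
    ; ⊙-homo = λ a f → ≋-trans (cong LF (⊙-homo LG a f)) (⊙-homo LF a (G f)) }

  ^[]-linear : ∀ {F : Coeff → Coeff} → IsLinear F → ∀ p → IsLinear (F ^[ p ])
  ^[]-linear L zero    = record { cong = λ f≋g → f≋g ; ⊕-homo = λ _ _ → ≋-refl ; ⊙-homo = λ _ _ → ≋-refl }
  ^[]-linear L (suc p) = ∘-linear L (^[]-linear L p)

  ^[]-comm : ∀ {F G : Coeff → Coeff} → IsLinear F → (∀ f → F (G f) ≋ G (F f)) →
             ∀ p f → (F ^[ p ]) (G f) ≋ G ((F ^[ p ]) f)
  ^[]-comm LF F∘G≋G∘F zero    f = ≋-refl
  ^[]-comm {F} LF F∘G≋G∘F (suc p) f = ≋-trans (cong LF (^[]-comm LF F∘G≋G∘F p f)) (F∘G≋G∘F ((F ^[ p ]) f))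

  ∇-shift : ∀ f → ∇ (shift f) ≋ shift (∇ f)
  ∇-shift f zero    = trans (+-congˡ -0#≈0#) (+-identityʳ 0#)
  ∇-shift f (suc J) = refl

  ^[]-shift^ : ∀ {F : Coeff → Coeff} → IsLinear F → (∀ f → F (shift f) ≋ shift (F f)) →
               ∀ a b f → (F ^[ a ]) ((shift ^[ b ]) f) ≋ (shift ^[ b ]) ((F ^[ a ]) f)
  ^[]-shift^ L F-shift a zero    f = ≋-refl
  ^[]-shift^ L F-shift a (suc b) f =
    ≋-trans (^[]-comm L F-shift a ((shift ^[ b ]) f)) (cong shift-linear (^[]-shift^ L F-shift a b f))

  ∇^-shift^ : ∀ a b f → (∇ ^[ a ]) ((shift ^[ b ]) f) ≋ (shift ^[ b ]) ((∇ ^[ a ]) f)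
  ∇^-shift^ = ^[]-shift^ ∇-linear ∇-shift

  shift∇^-split : ∀ p f → (shift∇ ^[ p ]) f ≋ (shift ^[ p ]) ((∇ ^[ p ]) f)
  shift∇^-split zero    f = ≋-refl
  shift∇^-split (suc p) f =
    cong shift-linear (≋-trans (cong ∇-linear (shift∇^-split p f)) (∇^-shift^ 1 p ((∇ ^[ p ]) f)))

  shift∇-linear : IsLinear shift∇
  shift∇-linear = ∘-linear shift-linear ∇-linear

  shift∇^-shift^ : ∀ a b f → (shift∇ ^[ a ]) ((shift ^[ b ]) f) ≋ (shift ^[ b ]) ((shift∇ ^[ a ]) f)
  shift∇^-shift^ = ^[]-shift^ shift∇-linear (cong shift-linear ∘ ∇-shift)

  VanishesFrom : ℕ → Coeff → Set ℓ
  VanishesFrom d f = ∀ J → d ≤ J → f J ≈ 0#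

  vanish-mono : ∀ {d d′ f} → d ≤ d′ → VanishesFrom d f → VanishesFrom d′ f
  vanish-mono d≤d′ f↓ J d′≤J = f↓ J (ℕₚ.≤-trans d≤d′ d′≤J)

  vanish-cong : ∀ {d f g} → f ≋ g → VanishesFrom d f → VanishesFrom d g
  vanish-cong f≋g f↓ J d≤J = trans (sym (f≋g J)) (f↓ J d≤J)

  vanish-⊕ : ∀ {d f g} → VanishesFrom d f → VanishesFrom d g → VanishesFrom d (f ⊕ g)
  vanish-⊕ f↓ g↓ J d≤J = trans (+-cong (f↓ J d≤J) (g↓ J d≤J)) (+-identityʳ 0#)

  vanish-⊖ : ∀ {d f g} → VanishesFrom d f → VanishesFrom d g → VanishesFrom d (f ⊖ g)
  vanish-⊖ f↓ g↓ J d≤J = trans (+-cong (f↓ J d≤J) (-‿cong (g↓ J d≤J))) (trans (+-congˡ -0#≈0#) (+-identityʳ 0#))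

  vanish-⊙ : ∀ {d} a {f} → VanishesFrom d f → VanishesFrom d (a ⊙ f)
  vanish-⊙ a f↓ J d≤J = trans (*-congˡ (f↓ J d≤J)) (zeroʳ a)

  vanish-0⊙ : ∀ d f → VanishesFrom d (0# ⊙ f)
  vanish-0⊙ d f J _ = zeroˡ (f J)

  vanish-Σᶜ : ∀ {d} e f → (∀ t → t < e → VanishesFrom d (f t)) → VanishesFrom d (Σᶜ e f)
  vanish-Σᶜ e f f↓ J d≤J = trans (Σ<-cong-< e (λ t t<e → f↓ t t<e J d≤J)) (Σ<-zero e)

  vanish-δ0 : VanishesFrom 1 (δ0 R)
  vanish-δ0 (suc J) _ = refl

  vanish-shift : ∀ {d f} → VanishesFrom d f → VanishesFrom (suc d) (shift f)
  vanish-shift f↓ (suc J) (s≤s d≤J) = f↓ J d≤J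

  vanish-∇ : ∀ {d f} → VanishesFrom d f → VanishesFrom (suc d) (∇ f)
  vanish-∇ {d} f↓ J d<J = vanish-⊖ (vanish-mono (ℕₚ.n≤1+n d) f↓) (vanish-shift f↓) J d<J

  vanish-^[] : ∀ {F : Coeff → Coeff} → (∀ {d f} → VanishesFrom d f → VanishesFrom (suc d) (F f)) →
               ∀ {d f} p → VanishesFrom d f → VanishesFrom (p ℕ.+ d) ((F ^[ p ]) f)
  vanish-^[] F↓ zero    f↓ = f↓
  vanish-^[] F↓ (suc p) f↓ = F↓ (vanish-^[] F↓ p f↓)

  vanish-shift∇^ : ∀ {d f} p → VanishesFrom d f → VanishesFrom (p ℕ.+ (p ℕ.+ d)) ((shift∇ ^[ p ]) f)
  vanish-shift∇^ p f↓ =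
    vanish-cong (≋-sym (shift∇^-split p _)) (vanish-^[] vanish-shift p (vanish-^[] vanish-∇ p f↓))

  powers : ℕ → Coeff
  powers e J = pow R (ι R J) e

  ∇-powers : ∀ e → ∇ (powers e) ≋ δ0 R e ⊙ δ0 R ⊕ shift (Σᶜ e (λ t → ι R (e C t) ⊙ powers t))
  ∇-powers e zero = begin
    pow R 0# e - 0#      ≈⟨ trans (+-congˡ -0#≈0#) (+-identityʳ _) ⟩
    pow R 0# e           ≈⟨ pow-0# e ⟩
    δ0 R e               ≈⟨ *-identityʳ _ ⟨
    δ0 R e * 1#          ≈⟨ +-identityʳ _ ⟨
    δ0 R e * 1# + 0#     ∎
  ∇-powers e (suc J) = begin
    pow R (1# + x) e - pow R x e                    ≈⟨ +-congʳ (binomial 1# x e) ⟩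
    (Σ< R e term + term e) - pow R x e ≈⟨ +-congʳ (+-congˡ top) ⟩
    (Σ< R e term + pow R x e) - pow R x e   ≈⟨ solve 2 (λ a b → (a :+ b) :- b := a) refl _ _ ⟩
    Σ< R e term
      ≈⟨ Σ<-cong e (λ t → *-congˡ (trans (*-congʳ (pow-1# (e ℕ.∸ t))) (*-identityˡ _))) ⟩
    Σ< R e (λ t → ι R (e C t) * pow R x t)           ≈⟨ +-identityˡ _ ⟨
    0# + Σ< R e (λ t → ι R (e C t) * pow R x t)      ≈⟨ +-congʳ (zeroʳ (δ0 R e)) ⟨
    δ0 R e * 0# + Σ< R e (λ t → ι R (e C t) * pow R x t) ∎
    where
    x : Carrier
    x = ι R J
    term : ℕ → Carrier
    term t = ι R (e C t) * (pow R 1# (e ℕ.∸ t) * pow R x t)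
    top : term e ≈ pow R x e
    top = begin
      ι R (e C e) * (pow R 1# (e ℕ.∸ e) * pow R x e)
        ≈⟨ *-cong (reflexive (≡.cong (ι R) (nCn≡1 e))) (*-congʳ (pow-1# (e ℕ.∸ e))) ⟩
      (1# + 0#) * (1# * pow R x e)
        ≈⟨ trans (*-congʳ (+-identityʳ 1#)) (trans (*-identityˡ _) (*-identityˡ _)) ⟩
      pow R x e                                       ∎

  ∇^-powers-vanish : ∀ p e → e < p → VanishesFrom p ((∇ ^[ p ]) (powers e))
  ∇^-powers-vanish (suc p) e (s≤s e≤p) = vanish-cong (≋-sym expand) (vanish-⊕ (first e) rest)
    where
    ∇^p : Coeff → Coeff
    ∇^p = ∇ ^[ p ]
    L : IsLinear ∇^p
    L = ^[]-linear ∇-linear p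
    expand : (∇ ^[ suc p ]) (powers e) ≋ δ0 R e ⊙ ∇^p (δ0 R) ⊕ shift (Σᶜ e (λ t → ι R (e C t) ⊙ ∇^p (powers t)))
    expand J = begin
      ∇ (∇^p (powers e)) J
        ≈⟨ ^[]-comm {G = ∇} ∇-linear (λ _ → ≋-refl) p (powers e) J ⟨
      ∇^p (∇ (powers e)) J                            ≈⟨ cong L (∇-powers e) J ⟩
      ∇^p (δ0 R e ⊙ δ0 R ⊕ shift (Σᶜ e _)) J          ≈⟨ ⊕-homo L _ _ J ⟩
      ∇^p (δ0 R e ⊙ δ0 R) J + ∇^p (shift (Σᶜ e _)) J  ≈⟨ +-cong (⊙-homo L _ _ J) (∇^-shift^ p 1 _ J) ⟩
      δ0 R e * ∇^p (δ0 R) J + shift (∇^p (Σᶜ e _)) J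
        ≈⟨ +-congˡ (cong shift-linear (≋-trans (Σᶜ-homo L e _) (λ J′ → Σ<-cong e (λ t → ⊙-homo L _ _ J′))) J) ⟩
      δ0 R e * ∇^p (δ0 R) J + shift (Σᶜ e (λ t → ι R (e C t) ⊙ ∇^p (powers t))) J ∎
    first : ∀ e → VanishesFrom (suc p) (δ0 R e ⊙ ∇^p (δ0 R))
    first zero    = vanish-⊙ 1# (vanish-mono (ℕₚ.≤-reflexive (ℕₚ.+-comm p 1)) (vanish-^[] vanish-∇ p vanish-δ0))
    first (suc _) = vanish-0⊙ (suc p) _
    rest : VanishesFrom (suc p) (shift (Σᶜ e (λ t → ι R (e C t) ⊙ ∇^p (powers t))))
    rest = vanish-shift (vanish-Σᶜ e _ (λ t t<e → vanish-⊙ _ (∇^-powers-vanish p t (ℕₚ.<-≤-trans t<e e≤p))))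

  ∇^-at-0 : ∀ p f → (∇ ^[ p ]) f 0 ≈ f 0
  ∇^-at-0 zero    f = refl
  ∇^-at-0 (suc p) f = trans (+-congˡ -0#≈0#) (trans (+-identityʳ _) (∇^-at-0 p f))

  ∇^-formula : ∀ p f J → (∇ ^[ p ]) f J ≈ Σ< R (suc J) (λ l → ιℤ R (sign l) * ι R (p C l) * f (J ℕ.∸ l))
  ∇^-formula zero f J = begin
    f J                                                 ≈⟨ one ⟨
    a₀                                                  ≈⟨ +-identityʳ a₀ ⟨
    a₀ + 0#                                             ≈⟨ +-congˡ (Σ<-zero J) ⟨
    a₀ + Σ< R J (λ _ → 0#)                              ≈⟨ +-congˡ (Σ<-cong J none) ⟨
    a₀ + Σ< R J (λ l → term (suc l))                    ≈⟨ Σ<-head J term ⟨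
    Σ< R (suc J) term                                   ∎
    where
    term : ℕ → Carrier
    term l = ιℤ R (sign l) * ι R (0 C l) * f (J ℕ.∸ l)
    a₀ : Carrier
    a₀ = term 0
    one : a₀ ≈ f J
    one = trans (*-congʳ (trans (*-cong (+-identityʳ 1#) (+-identityʳ 1#)) (*-identityˡ 1#))) (*-identityˡ _)
    none : ∀ l → term (suc l) ≈ 0#
    none l = trans (*-congʳ (trans (*-congˡ (ι-C {0} {suc l} (s≤s z≤n))) (zeroʳ _))) (zeroˡ _)
  ∇^-formula (suc p) f zero = trans (+-congˡ -0#≈0#) (trans (+-identityʳ _) (∇^-formula p f zero))
  ∇^-formula (suc p) f (suc J) = begin
    (∇ ^[ p ]) f (suc J) - (∇ ^[ p ]) f J
      ≈⟨ +-cong (trans (∇^-formula p f (suc J)) (Σ<-head (suc J) _)) (-‿cong (∇^-formula p f J)) ⟩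
    (a₀ + Σ< R (suc J) below) - Σ< R (suc J) same          ≈⟨ +-assoc _ _ _ ⟩
    a₀ + (Σ< R (suc J) below - Σ< R (suc J) same)          ≈⟨ +-congˡ (Σ<-sub (suc J) below same) ⟨
    a₀ + Σ< R (suc J) (λ l → below l - same l)             ≈⟨ +-congˡ (Σ<-cong (suc J) pascal) ⟩
    a₀ + Σ< R (suc J) (λ l → ιℤ R (sign (suc l)) * ι R (suc p C suc l) * f (J ℕ.∸ l)) ≈⟨ Σ<-head (suc J) _ ⟨
    Σ< R (suc (suc J)) (λ l → ιℤ R (sign l) * ι R (suc p C l) * f (suc J ℕ.∸ l)) ∎
    where
    a₀ : Carrier
    a₀ = ιℤ R (sign 0) * ι R (p C 0) * f (suc J)
    below same : ℕ → Carrier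
    below l = ιℤ R (sign (suc l)) * ι R (p C suc l) * f (J ℕ.∸ l)
    same  l = ιℤ R (sign l) * ι R (p C l) * f (J ℕ.∸ l)
    pascal : ∀ l → below l - same l ≈ ιℤ R (sign (suc l)) * ι R (suc p C suc l) * f (J ℕ.∸ l)
    pascal l = begin
      s′ * a * z - s * b * z          ≈⟨ +-congˡ (-‿cong (*-congʳ (*-congʳ s≈-s′))) ⟩
      s′ * a * z - (- s′) * b * z
        ≈⟨ solve 4 (λ s′ a b z → s′ :* a :* z :- (:- s′) :* b :* z := s′ :* (b :+ a) :* z) refl s′ a b z ⟩
      s′ * (b + a) * z                ≈⟨ *-congʳ (*-congˡ (ι-Pascal p l)) ⟩
      s′ * ι R (suc p C suc l) * z    ∎
      where
      s : Carrier
      s = ιℤ R (sign l)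
      s′ : Carrier
      s′ = ιℤ R (sign (suc l))
      a = ι R (p C suc l)
      b = ι R (p C l)
      z : Carrier
      z = f (J ℕ.∸ l)
      s≈-s′ : s ≈ - s′
      s≈-s′ = trans (sym (-‿involutive s)) (-‿cong (sym (ιℤ-neg (sign l))))

  ιℤ-ℤsum≤ : ∀ J f → ιℤ R (ℤsum≤ J f) ≈ Σ< R (suc J) (ιℤ R ∘ f)
  ιℤ-ℤsum≤ zero    f = sym (+-identityˡ _)
  ιℤ-ℤsum≤ (suc J) f = trans (ιℤ-+ (ℤsum≤ J f) (f (suc J))) (+-congʳ (ιℤ-ℤsum≤ J f))

  eulerian : ℕ → Coeff
  eulerian s = (∇ ^[ suc s ]) (powers s)

  eulerian-vanishes : ∀ s → VanishesFrom (suc s) (eulerian s)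
  eulerian-vanishes s = ∇^-powers-vanish (suc s) s (ℕₚ.n<1+n s)

  eulerian-at-0 : ∀ s → eulerian (suc s) 0 ≈ 0#
  eulerian-at-0 s = trans (∇^-at-0 (suc (suc s)) (powers (suc s))) (zeroˡ _)

  eulerian≈Eulerian : ∀ s J → eulerian s J ≈ ιℤ R (Eulerian s J)
  eulerian≈Eulerian s J = begin
    eulerian s J                                             ≈⟨ ∇^-formula (suc s) (powers s) J ⟩
    Σ< R (suc J) (λ t → ιℤ R (sign t) * ι R (suc s C t) * powers s (J ℕ.∸ t)) ≈⟨ Σ<-cong (suc J) term ⟨
    Σ< R (suc J) (ιℤ R ∘ summand)                            ≈⟨ ιℤ-ℤsum≤ J summand ⟨
    ιℤ R (Eulerian s J)                                      ∎
    where
    summand : ℕ → ℤ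
    summand t = sign t ℤ.* + (suc s C t) ℤ.* + ((J ℕ.∸ t) ℕ.^ s)
    term : ∀ t → ιℤ R (summand t) ≈ ιℤ R (sign t) * ι R (suc s C t) * powers s (J ℕ.∸ t)
    term t = trans (ιℤ-* (sign t ℤ.* + (suc s C t)) (+ ((J ℕ.∸ t) ℕ.^ s)))
                   (*-cong (ιℤ-* (sign t) (+ (suc s C t))) (ι-^ (J ℕ.∸ t) s))

  shift^-below : ∀ n f J → J < n → (shift ^[ n ]) f J ≈ 0#
  shift^-below (suc n) f zero    _         = refl
  shift^-below (suc n) f (suc J) (s≤s J<n) = shift^-below n f J J<n

  shift^-from : ∀ n f i → (shift ^[ n ]) f (n ℕ.+ i) ≡ f i
  shift^-from zero    f i = ≡.refl
  shift^-from (suc n) f i = shift^-from n f i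

  shift∇^-powers : ∀ p s → (shift∇ ^[ p ℕ.+ suc s ]) (powers s) ≋ (shift∇ ^[ p ]) ((shift ^[ suc s ]) (eulerian s))
  shift∇^-powers p s = ≋-trans (≋-reflexive (^[]-+ shift∇ p (suc s) (powers s)))
                               (cong (^[]-linear shift∇-linear p) (shift∇^-split (suc s) (powers s)))

  module Truncation (m n : ℕ) where
    nᵐ : Carrier
    nᵐ = pow R (ι R n) m

    κ : ℕ → Carrier
    κ s = ι R (m C s) * pow R (ι R n) (m ℕ.∸ s)

    -- H and T of the proof idea: truncated is k^m for k ≤ n and 0 beyond.
    tail : Coeff
    tail = Σᶜ (suc m) (λ s → κ s ⊙ powers s) ⊖ nᵐ ⊙ δ0 R

    truncated : Coeff
    truncated = powers m ⊖ (shift ^[ n ]) tail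

    tail-at : ∀ i → powers m (n ℕ.+ i) - tail i ≈ nᵐ * δ0 R i
    tail-at i = begin
      powers m (n ℕ.+ i) - (Σ< R (suc m) (λ s → κ s * pow R (ι R i) s) - nᵐ * δ0 R i)
        ≈⟨ +-congˡ (-‿cong (+-congʳ (Σ<-cong (suc m) (λ s → *-assoc _ _ _)))) ⟩
      powers m (n ℕ.+ i)
        - (Σ< R (suc m) (λ s → ι R (m C s) * (pow R (ι R n) (m ℕ.∸ s) * pow R (ι R i) s)) - nᵐ * δ0 R i)
        ≈⟨ +-congˡ (-‿cong (+-congʳ (binomial (ι R n) (ι R i) m))) ⟨
      powers m (n ℕ.+ i) - (pow R (ι R n + ι R i) m - nᵐ * δ0 R i)
        ≈⟨ +-congˡ (-‿cong (+-congʳ (pow-congˡ m (ι-+ n i)))) ⟨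
      powers m (n ℕ.+ i) - (powers m (n ℕ.+ i) - nᵐ * δ0 R i)
        ≈⟨ solve 2 (λ a b → a :- (a :- b) := b) refl _ _ ⟩
      nᵐ * δ0 R i ∎

    truncated-below : ∀ J → J < n → truncated J ≈ powers m J
    truncated-below J J<n =
      trans (+-congˡ (trans (-‿cong (shift^-below n tail J J<n)) -0#≈0#)) (+-identityʳ _)

    truncated-from : ∀ i → truncated (n ℕ.+ i) ≈ nᵐ * δ0 R i
    truncated-from i = trans (+-congˡ (-‿cong (reflexive (shift^-from n tail i)))) (tail-at i)

    truncated≈powers : ∀ J → J < suc n → truncated J ≈ powers m J
    truncated≈powers J J<1+n with ℕₚ.m≤n⇒m<n∨m≡n (s≤s⁻¹ J<1+n)
    ... | inj₁ J<n    = truncated-below J J<n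
    ... | inj₂ ≡.refl = begin
      truncated J             ≡⟨ ≡.cong truncated (ℕₚ.+-identityʳ J) ⟨
      truncated (J ℕ.+ 0)     ≈⟨ truncated-from 0 ⟩
      nᵐ * 1#                 ≈⟨ *-identityʳ nᵐ ⟩
      powers m J              ∎

    truncated-vanishes : VanishesFrom (suc n) truncated
    truncated-vanishes J n<J = begin
      truncated J                   ≡⟨ ≡.cong truncated (ℕₚ.m+[n∸m]≡n (ℕₚ.<⇒≤ n<J)) ⟨
      truncated (n ℕ.+ (J ℕ.∸ n))   ≈⟨ truncated-from (J ℕ.∸ n) ⟩
      nᵐ * δ0 R (J ℕ.∸ n)           ≈⟨ vanish-⊙ nᵐ vanish-δ0 (J ℕ.∸ n) (ℕₚ.m<n⇒0<n∸m n<J) ⟩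
      0#                            ∎

    eulerianPart : Coeff
    eulerianPart = (shift ^[ suc m ]) (eulerian m)

    boundaryTerm : ℕ → Coeff
    boundaryTerm s = (shift∇ ^[ m ℕ.∸ s ]) ((shift ^[ suc s ]) (eulerian s))

    boundaryPart : Coeff
    boundaryPart = Σᶜ (suc m) (λ s → κ s ⊙ boundaryTerm s) ⊖ nᵐ ⊙ (shift∇ ^[ suc m ]) (δ0 R)

    shift∇^-powers-≤ : ∀ s → s ≤ m → (shift∇ ^[ suc m ]) (powers s) ≋ boundaryTerm s
    shift∇^-powers-≤ s s≤m = ≋-trans (≋-reflexive (≡.cong (λ p → (shift∇ ^[ p ]) (powers s)) m-s+1+s≡1+m))
                                     (shift∇^-powers (m ℕ.∸ s) s)
      where
      m-s+1+s≡1+m : suc m ≡ m ℕ.∸ s ℕ.+ suc s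
      m-s+1+s≡1+m = ≡.sym (≡.trans (ℕₚ.+-suc (m ℕ.∸ s) s) (≡.cong suc (ℕₚ.m∸n+n≡m s≤m)))

    shift∇^-tail : (shift∇ ^[ suc m ]) tail ≋ boundaryPart
    shift∇^-tail J = begin
      L tail J                                                   ≈⟨ ⊖-homo Lᵢ _ _ J ⟩
      L (Σᶜ (suc m) (λ s → κ s ⊙ powers s)) J - L (nᵐ ⊙ δ0 R) J
        ≈⟨ +-cong (Σᶜ-homo Lᵢ (suc m) _ J) (-‿cong (⊙-homo Lᵢ nᵐ (δ0 R) J)) ⟩
      Σ< R (suc m) (λ s → L (κ s ⊙ powers s) J) - nᵐ * L (δ0 R) J ≈⟨ +-congʳ (Σ<-cong-< (suc m) term) ⟩
      boundaryPart J                                             ∎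
      where
      L : Coeff → Coeff
      L = shift∇ ^[ suc m ]
      Lᵢ : IsLinear L
      Lᵢ = ^[]-linear shift∇-linear (suc m)
      term : ∀ s → s < suc m → L (κ s ⊙ powers s) J ≈ κ s * boundaryTerm s J
      term s s<1+m = trans (⊙-homo Lᵢ (κ s) (powers s) J) (*-congˡ (shift∇^-powers-≤ s (s≤s⁻¹ s<1+m) J))

    shift∇^-truncated : (shift∇ ^[ suc m ]) truncated ≋ eulerianPart ⊖ (shift ^[ n ]) boundaryPart
    shift∇^-truncated J = begin
      L truncated J                                    ≈⟨ ⊖-homo Lᵢ (powers m) _ J ⟩
      L (powers m) J - L ((shift ^[ n ]) tail) J
        ≈⟨ +-cong (shift∇^-powers 0 m J) (-‿cong (shift∇^-shift^ (suc m) n tail J)) ⟩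
      eulerianPart J - (shift ^[ n ]) (L tail) J
        ≈⟨ +-congˡ (-‿cong (cong (^[]-linear shift-linear n) shift∇^-tail J)) ⟩
      eulerianPart J - (shift ^[ n ]) boundaryPart J   ∎
      where
      L : Coeff → Coeff
      L = shift∇ ^[ suc m ]
      Lᵢ : IsLinear L
      Lᵢ = ^[]-linear shift∇-linear (suc m)

    support : ℕ
    support = suc m ℕ.+ (suc m ℕ.+ 1)

    -- The bound comes from the form shift^(m+1) (∇^(m+1) (powers s)), not from boundaryTerm s.
    boundaryTerm-vanishes : ∀ s → s < suc m → VanishesFrom support (boundaryTerm s)
    boundaryTerm-vanishes s s<1+m =
      vanish-mono (ℕₚ.+-monoʳ-≤ (suc m) (ℕₚ.m≤m+n (suc m) 1))
        (vanish-cong (≋-trans (≋-sym (shift∇^-split (suc m) (powers s))) (shift∇^-powers-≤ s (s≤s⁻¹ s<1+m)))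
          (vanish-^[] vanish-shift (suc m) (∇^-powers-vanish (suc m) s s<1+m)))

    boundaryPart-vanishes : VanishesFrom support boundaryPart
    boundaryPart-vanishes =
      vanish-⊖ (vanish-Σᶜ (suc m) _ (λ s s<1+m → vanish-⊙ (κ s) (boundaryTerm-vanishes s s<1+m)))
               (vanish-⊙ nᵐ (vanish-shift∇^ (suc m) vanish-δ0))

  SatisfiesRecurrence : Carrier → (ℕ → Carrier) → Set ℓ
  SatisfiesRecurrence q v = ∀ k → v (suc (suc k)) ≈ v (suc k) - q * v k

  module Evaluation (q : Carrier) (v : ℕ → Carrier) (v-rec : SatisfiesRecurrence q v) where

    eval : ℕ → Coeff → ℕ → Carrier
    eval d f k = Σ< R d (λ J → f J * v (k ℕ.+ J))

    eval-cong : ∀ d {f g} k → f ≋ g → eval d f k ≈ eval d g k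
    eval-cong d k f≋g = Σ<-cong d (λ J → *-congʳ (f≋g J))

    eval-⊖ : ∀ d f g k → eval d (f ⊖ g) k ≈ eval d f k - eval d g k
    eval-⊖ d f g k = trans (Σ<-cong d (λ J → trans (distribʳ _ _ _) (+-congˡ (sym (-‿distribˡ-* _ _))))) (Σ<-sub d _ _)

    eval-⊙ : ∀ d a f k → eval d (a ⊙ f) k ≈ a * eval d f k
    eval-⊙ d a f k = trans (Σ<-cong d (λ J → *-assoc _ _ _)) (sym (Σ<-distribˡ d a _))

    eval-Σᶜ : ∀ d e f k → eval d (Σᶜ e f) k ≈ Σ< R e (λ t → eval d (f t) k)
    eval-Σᶜ d e f k = trans (Σ<-cong d (λ J → Σ<-distribʳ e _ _)) (Σ<-comm d e _)

    eval-extend : ∀ {d D f} k → d ≤ D → VanishesFrom d f → eval D f k ≈ eval d f k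
    eval-extend {d} {D} {f} k d≤D f↓ = begin
      eval D f k                  ≡⟨ ≡.cong (λ D → eval D f k) (ℕₚ.m∸n+n≡m d≤D) ⟨
      eval (D ℕ.∸ d ℕ.+ d) f k    ≈⟨ Σ<-pad d (D ℕ.∸ d) _ (λ J d≤J → trans (*-congʳ (f↓ J d≤J)) (zeroˡ _)) ⟩
      eval d f k                  ∎

    eval-resize : ∀ {d d′ f} k → VanishesFrom d f → VanishesFrom d′ f → eval d f k ≈ eval d′ f k
    eval-resize {d} {d′} k f↓ f↓′ with ℕₚ.≤-total d d′
    ... | inj₁ d≤d′ = sym (eval-extend k d≤d′ f↓)
    ... | inj₂ d′≤d = eval-extend k d′≤d f↓′

    eval-shift : ∀ d f k → eval (suc d) (shift f) k ≈ eval d f (suc k)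
    eval-shift d f k = begin
      eval (suc d) (shift f) k                              ≈⟨ Σ<-head d _ ⟩
      0# * v (k ℕ.+ 0) + Σ< R d (λ J → f J * v (k ℕ.+ suc J)) ≈⟨ trans (+-congʳ (zeroˡ _)) (+-identityˡ _) ⟩
      Σ< R d (λ J → f J * v (k ℕ.+ suc J))
        ≈⟨ Σ<-cong d (λ J → *-congˡ (reflexive (≡.cong v (ℕₚ.+-suc k J)))) ⟩
      eval d f (suc k)                                      ∎

    eval-shift^ : ∀ p d f k → eval (p ℕ.+ d) ((shift ^[ p ]) f) k ≈ eval d f (k ℕ.+ p)
    eval-shift^ zero    d f k = reflexive (≡.cong (eval d f) (≡.sym (ℕₚ.+-identityʳ k)))
    eval-shift^ (suc p) d f k = begin
      eval (suc p ℕ.+ d) ((shift ^[ suc p ]) f) k   ≈⟨ eval-shift (p ℕ.+ d) _ k ⟩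
      eval (p ℕ.+ d) ((shift ^[ p ]) f) (suc k)     ≈⟨ eval-shift^ p d f (suc k) ⟩
      eval d f (suc k ℕ.+ p)                        ≡⟨ ≡.cong (eval d f) (ℕₚ.+-suc k p) ⟨
      eval d f (k ℕ.+ suc p)                        ∎

    eval-shift∇ : ∀ {d f} k → VanishesFrom d f → eval (suc (suc d)) (shift∇ f) k ≈ q * eval d f k
    eval-shift∇ {d} {f} k f↓ = begin
      eval (suc (suc d)) (shift (∇ f)) k                    ≈⟨ eval-shift (suc d) (∇ f) k ⟩
      eval (suc d) (f ⊖ shift f) (suc k)                    ≈⟨ eval-⊖ (suc d) f (shift f) (suc k) ⟩
      eval (suc d) f (suc k) - eval (suc d) (shift f) (suc k)
        ≈⟨ +-cong (eval-extend (suc k) (ℕₚ.n≤1+n d) f↓) (-‿cong (eval-shift d f (suc k))) ⟩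
      eval d f (suc k) - eval d f (suc (suc k))             ≈⟨ Σ<-sub d _ _ ⟨
      Σ< R d (λ J → f J * v (suc (k ℕ.+ J)) - f J * v (suc (suc (k ℕ.+ J)))) ≈⟨ Σ<-cong d recurrence ⟩
      Σ< R d (λ J → q * (f J * v (k ℕ.+ J)))                ≈⟨ Σ<-distribˡ d q _ ⟨
      q * eval d f k                                        ∎
      where
      recurrence : ∀ J → f J * v (suc (k ℕ.+ J)) - f J * v (suc (suc (k ℕ.+ J))) ≈ q * (f J * v (k ℕ.+ J))
      recurrence J = begin
        f J * v (suc i) - f J * v (suc (suc i))        ≈⟨ +-congˡ (-‿cong (*-congˡ (v-rec i))) ⟩
        f J * v (suc i) - f J * (v (suc i) - q * v i)
          ≈⟨ solve 4 (λ a x y q → a :* x :- a :* (x :- q :* y) := q :* (a :* y)) refl _ _ _ _ ⟩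
        q * (f J * v i)                                ∎
        where
        i : ℕ
        i = k ℕ.+ J

    eval-shift∇^ : ∀ p {d f} k → VanishesFrom d f →
                   eval (p ℕ.+ (p ℕ.+ d)) ((shift∇ ^[ p ]) f) k ≈ pow R q p * eval d f k
    eval-shift∇^ zero    k f↓ = sym (*-identityˡ _)
    eval-shift∇^ (suc p) {d} {f} k f↓ = begin
      eval (suc p ℕ.+ (suc p ℕ.+ d)) (shift∇ g) k
        ≡⟨ ≡.cong (λ D → eval (suc D) (shift∇ g) k) (ℕₚ.+-suc p (p ℕ.+ d)) ⟩
      eval (suc (suc (p ℕ.+ (p ℕ.+ d)))) (shift∇ g) k ≈⟨ eval-shift∇ k (vanish-shift∇^ p f↓) ⟩
      q * eval (p ℕ.+ (p ℕ.+ d)) g k                 ≈⟨ *-congˡ (eval-shift∇^ p k f↓) ⟩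
      q * (pow R q p * eval d f k)                   ≈⟨ *-assoc _ _ _ ⟨
      pow R q (suc p) * eval d f k                   ∎
      where
      g : Coeff
      g = (shift∇ ^[ p ]) f

    module PowerSum (m n : ℕ) where
      open Truncation m n

      eval-boundaryTerm : ∀ s → s < suc m →
        eval support (boundaryTerm s) n ≈ pow R q (m ℕ.∸ s) * eval (suc s) (eulerian s) (n ℕ.+ suc s)
      eval-boundaryTerm s s<1+m = begin
        eval support (boundaryTerm s) n
          ≈⟨ eval-resize n (boundaryTerm-vanishes s s<1+m) (vanish-shift∇^ (m ℕ.∸ s) shifted↓) ⟩
        eval ((m ℕ.∸ s) ℕ.+ ((m ℕ.∸ s) ℕ.+ (suc s ℕ.+ suc s))) (boundaryTerm s) n
          ≈⟨ eval-shift∇^ (m ℕ.∸ s) n shifted↓ ⟩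
        pow R q (m ℕ.∸ s) * eval (suc s ℕ.+ suc s) ((shift ^[ suc s ]) (eulerian s)) n
          ≈⟨ *-congˡ (eval-shift^ (suc s) (suc s) (eulerian s) n) ⟩
        pow R q (m ℕ.∸ s) * eval (suc s) (eulerian s) (n ℕ.+ suc s) ∎
        where
        shifted↓ : VanishesFrom (suc s ℕ.+ suc s) ((shift ^[ suc s ]) (eulerian s))
        shifted↓ = vanish-^[] vanish-shift (suc s) (eulerian-vanishes s)

      eval-boundaryPart : eval support boundaryPart n ≈
        Σ< R (suc m) (λ s → κ s * (pow R q (m ℕ.∸ s) * eval (suc s) (eulerian s) (n ℕ.+ suc s)))
        - nᵐ * (pow R q (suc m) * v n)
      eval-boundaryPart = begin
        eval support boundaryPart n                       ≈⟨ eval-⊖ support _ _ n ⟩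
        eval support (Σᶜ (suc m) (λ s → κ s ⊙ boundaryTerm s)) n - eval support (nᵐ ⊙ δTerm) n
          ≈⟨ +-cong (eval-Σᶜ support (suc m) _ n) (-‿cong (eval-⊙ support nᵐ _ n)) ⟩
        Σ< R (suc m) (λ s → eval support (κ s ⊙ boundaryTerm s) n) - nᵐ * eval support δTerm n
          ≈⟨ +-cong (Σ<-cong-< (suc m) (λ s s<1+m → trans (eval-⊙ support (κ s) _ n) (*-congˡ (eval-boundaryTerm s s<1+m))))
                    (-‿cong (*-congˡ (trans (eval-shift∇^ (suc m) n vanish-δ0) (*-congˡ eval-δ0)))) ⟩
        Σ< R (suc m) (λ s → κ s * (pow R q (m ℕ.∸ s) * eval (suc s) (eulerian s) (n ℕ.+ suc s)))
        - nᵐ * (pow R q (suc m) * v n)               ∎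
        where
        δTerm : Coeff
        δTerm = (shift∇ ^[ suc m ]) (δ0 R)
        eval-δ0 : eval 1 (δ0 R) n ≈ v n
        eval-δ0 = trans (+-identityˡ _) (trans (*-identityˡ _) (reflexive (≡.cong v (ℕₚ.+-identityʳ n))))

      powerSum-eval : pow R q (suc m) * Σ< R (suc n) (λ j → pow R (ι R j) m * v j)
        ≈ eval (suc m) (eulerian m) (suc m)
          - (Σ< R (suc m) (λ s → κ s * (pow R q (m ℕ.∸ s) * eval (suc s) (eulerian s) (n ℕ.+ suc s)))
             - nᵐ * (pow R q (suc m) * v n))
      powerSum-eval = begin
        pow R q (suc m) * Σ< R (suc n) (λ j → pow R (ι R j) m * v j)
          ≈⟨ *-congˡ (Σ<-cong-< (suc n) (λ J J<1+n → *-congʳ (truncated≈powers J J<1+n))) ⟨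
        pow R q (suc m) * eval (suc n) truncated 0          ≈⟨ eval-shift∇^ (suc m) 0 truncated-vanishes ⟨
        eval D ((shift∇ ^[ suc m ]) truncated) 0            ≈⟨ eval-cong D 0 shift∇^-truncated ⟩
        eval D (eulerianPart ⊖ (shift ^[ n ]) boundaryPart) 0 ≈⟨ eval-⊖ D _ _ 0 ⟩
        eval D eulerianPart 0 - eval D ((shift ^[ n ]) boundaryPart) 0
          ≈⟨ +-cong (eval-extend 0 eulerian≤D (vanish-^[] vanish-shift (suc m) (eulerian-vanishes m)))
                    (-‿cong (eval-extend 0 boundary≤D (vanish-^[] vanish-shift n boundaryPart-vanishes))) ⟩
        eval (suc m ℕ.+ suc m) eulerianPart 0 - eval (n ℕ.+ support) ((shift ^[ n ]) boundaryPart) 0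
          ≈⟨ +-cong (eval-shift^ (suc m) (suc m) (eulerian m) 0)
                    (-‿cong (trans (eval-shift^ n support boundaryPart 0) eval-boundaryPart)) ⟩
        eval (suc m) (eulerian m) (suc m)
          - (Σ< R (suc m) (λ s → κ s * (pow R q (m ℕ.∸ s) * eval (suc s) (eulerian s) (n ℕ.+ suc s)))
             - nᵐ * (pow R q (suc m) * v n)) ∎
        where
        D : ℕ
        D = suc m ℕ.+ (suc m ℕ.+ suc n)
        eulerian≤D : suc m ℕ.+ suc m ≤ D
        eulerian≤D = ℕₚ.+-monoʳ-≤ (suc m) (ℕₚ.m≤m+n (suc m) (suc n))
        boundary≤D : n ℕ.+ support ≤ D
        boundary≤D = ℕₚ.≤-reflexive (≡.trans (ℕₚ.+-comm n support)
          (≡.trans (ℕₚ.+-assoc (suc m) (suc m ℕ.+ 1) n) (≡.cong (suc m ℕ.+_) (ℕₚ.+-assoc (suc m) 1 n))))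

  expand-by-fundamental : ∀ {q u v} → SatisfiesRecurrence q u → u 0 ≈ 0# → u 1 ≈ 1# →
    SatisfiesRecurrence q v → ∀ n K → v (suc K ℕ.+ n) ≈ u (suc K) * v (suc n) - q * u K * v n
  expand-by-fundamental {q} {u} {v} u-rec u0 u1 v-rec n K = proj₁ (consecutive K)
    where
    expansion : ℕ → Carrier
    expansion K = u (suc K) * v (suc n) - q * u K * v n

    consecutive : ∀ K → v (suc K ℕ.+ n) ≈ expansion K × v (suc (suc K) ℕ.+ n) ≈ expansion (suc K)
    consecutive zero = sym base₀ , sym base₁
      where
      x-0≈x : ∀ x → x - 0# ≈ x
      x-0≈x x = trans (+-congˡ -0#≈0#) (+-identityʳ x)
      u2≈1 : u 2 ≈ 1#
      u2≈1 = trans (u-rec 0) (trans (+-cong u1 (-‿cong (trans (*-congˡ u0) (zeroʳ q)))) (x-0≈x 1#))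
      base₀ : expansion 0 ≈ v (suc n)
      base₀ = begin
        u 1 * v (suc n) - q * u 0 * v n
          ≈⟨ +-cong (*-congʳ u1) (-‿cong (trans (*-congʳ (trans (*-congˡ u0) (zeroʳ q))) (zeroˡ _))) ⟩
        1# * v (suc n) - 0#               ≈⟨ x-0≈x _ ⟩
        1# * v (suc n)                    ≈⟨ *-identityˡ _ ⟩
        v (suc n)                         ∎
      base₁ : expansion 1 ≈ v (suc (suc n))
      base₁ = begin
        u 2 * v (suc n) - q * u 1 * v n
          ≈⟨ +-cong (trans (*-congʳ u2≈1) (*-identityˡ _)) (-‿cong (*-congʳ (trans (*-congˡ u1) (*-identityʳ q)))) ⟩
        v (suc n) - q * v n               ≈⟨ v-rec n ⟨
        v (suc (suc n))                   ∎
    consecutive (suc K) with consecutive K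
    ... | eq₀ , eq₁ = eq₁ , (begin
      v (suc (suc (suc K)) ℕ.+ n)                  ≈⟨ v-rec (suc K ℕ.+ n) ⟩
      v (suc (suc K) ℕ.+ n) - q * v (suc K ℕ.+ n)  ≈⟨ +-cong eq₁ (-‿cong (*-congˡ eq₀)) ⟩
      expansion (suc K) - q * expansion K
        ≈⟨ solve 6 (λ u₂ u₁ u₀ x y q → (u₂ :* x :- q :* u₁ :* y) :- q :* (u₁ :* x :- q :* u₀ :* y)
                                       := (u₂ :- q :* u₁) :* x :- q :* (u₁ :- q :* u₀) :* y) refl _ _ _ _ _ _ ⟩
      (u (suc (suc K)) - q * u (suc K)) * v (suc n) - q * (u (suc K) - q * u K) * v n
        ≈⟨ +-cong (*-congʳ (u-rec (suc K))) (-‿cong (*-congʳ (*-congˡ (u-rec K)))) ⟨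
      expansion (suc (suc K))                      ∎)

  module Horadam (q qinv a b : Carrier) (qq : q * qinv ≈ 1#) where
    open Seq R q qinv a b

    wPos-suc : ∀ n → wPos (suc n) ≡ (proj₂ (wPos n) , proj₂ (wPos n) - q * proj₁ (wPos n))
    wPos-suc n with wPos n
    ... | _ , _ = ≡.refl

    wNeg-suc : ∀ n → wNeg (suc n) ≡ ((proj₁ (wNeg n) - proj₂ (wNeg n)) * qinv , proj₁ (wNeg n))
    wNeg-suc n with wNeg n
    ... | _ , _ = ≡.refl

    backward-step : ∀ x y → y ≈ x - q * ((x - y) * qinv)
    backward-step x y = begin
      y                              ≈⟨ solve 2 (λ x y → y := x :- (x :- y)) refl x y ⟩
      x - (x - y)                    ≈⟨ +-congˡ (-‿cong (trans (*-congˡ qq) (*-identityʳ _))) ⟨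
      x - (x - y) * (q * qinv)
        ≈⟨ +-congˡ (-‿cong (solve 3 (λ z q i → z :* (q :* i) := q :* (z :* i)) refl (x - y) q qinv)) ⟩
      x - q * ((x - y) * qinv)       ∎

    wStar-recurrence : ∀ z → w (ℤ.suc (ℤ.suc z)) ≈ w (ℤ.suc z) - q * w z
    wStar-recurrence (+ n) = begin
      proj₁ (wPos (suc (suc n)))                 ≡⟨ ≡.cong proj₁ (wPos-suc (suc n)) ⟩
      proj₂ (wPos (suc n))                       ≡⟨ ≡.cong proj₂ (wPos-suc n) ⟩
      proj₂ (wPos n) - q * proj₁ (wPos n)        ≡⟨ ≡.cong (λ x → x - q * proj₁ (wPos n)) (≡.cong proj₁ (wPos-suc n)) ⟨
      proj₁ (wPos (suc n)) - q * proj₁ (wPos n)  ∎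
    wStar-recurrence -[1+ zero ]        = backward-step a b
    wStar-recurrence -[1+ suc zero ]    = backward-step (proj₁ (wNeg 0)) a
    wStar-recurrence -[1+ suc (suc k) ] = begin
      proj₁ (wNeg k)             ≡⟨ ≡.cong proj₂ (wNeg-suc k) ⟨
      proj₂ (wNeg (suc k))       ≈⟨ backward-step _ _ ⟩
      proj₁ (wNeg (suc k)) - q * ((proj₁ (wNeg (suc k)) - proj₂ (wNeg (suc k))) * qinv)
        ≡⟨ ≡.cong (λ x → proj₁ (wNeg (suc k)) - q * x) (≡.cong proj₁ (wNeg-suc (suc k))) ⟨
      proj₁ (wNeg (suc k)) - q * proj₁ (wNeg (suc (suc k))) ∎

    shifted-recurrence : ∀ r → SatisfiesRecurrence q (λ k → w (+ k ℤ.+ r))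
    shifted-recurrence r k = begin
      w (+ suc (suc k) ℤ.+ r)                 ≡⟨ ≡.cong w (≡.trans (sucˡ (suc k)) (≡.cong ℤ.suc (sucˡ k))) ⟩
      w (ℤ.suc (ℤ.suc (+ k ℤ.+ r)))           ≈⟨ wStar-recurrence (+ k ℤ.+ r) ⟩
      w (ℤ.suc (+ k ℤ.+ r)) - q * w (+ k ℤ.+ r) ≡⟨ ≡.cong (λ i → w i - q * w (+ k ℤ.+ r)) (sucˡ k) ⟨
      w (+ suc k ℤ.+ r) - q * w (+ k ℤ.+ r)   ∎
      where
      sucˡ : ∀ k → + suc k ℤ.+ r ≡ ℤ.suc (+ k ℤ.+ r)
      sucˡ k = ℤₚ.+-assoc (+ 1) (+ k) r

  module ClosedForm (q qinv : Carrier) (qq : q * qinv ≈ 1#) (v u : ℕ → Carrier)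
                    (v-rec : SatisfiesRecurrence q v) (u-rec : SatisfiesRecurrence q u)
                    (u0 : u 0 ≈ 0#) (u1 : u 1 ≈ 1#) (m n : ℕ) where
    open Evaluation q v v-rec
    open PowerSum m n
    open Truncation m n

    A : ℕ → ℕ → Carrier
    A i j = ιℤ R (Eulerian i j)

    uSum : ℕ → ℕ → Carrier
    uSum k s = Σ1 R s (λ j → A s j * u (j ℕ.+ s ℕ.+ k))

    inner : ℕ → Carrier
    inner k = Σ1 R m (λ s → ι R (m C s) * pow R (ι R n) (m ℕ.∸ s) * pow R qinv (suc s) * uSum k s)

    boundaryValue : ℕ → Carrier
    boundaryValue s = eval (suc s) (eulerian s) (n ℕ.+ suc s)

    boundaryValue-zero : boundaryValue 0 ≈ v (suc n)
    boundaryValue-zero = begin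
      0# + eulerian 0 0 * v (n ℕ.+ 1 ℕ.+ 0) ≈⟨ +-identityˡ _ ⟩
      eulerian 0 0 * v (n ℕ.+ 1 ℕ.+ 0)     ≈⟨ *-cong (∇^-at-0 1 (powers 0)) (reflexive (≡.cong v index)) ⟩
      1# * v (suc n)                       ≈⟨ *-identityˡ _ ⟩
      v (suc n)                            ∎
      where
      index : n ℕ.+ 1 ℕ.+ 0 ≡ suc n
      index = ≡.trans (ℕₚ.+-identityʳ (n ℕ.+ 1)) (ℕₚ.+-comm n 1)

    boundaryValue-suc : ∀ s → boundaryValue (suc s) ≈ uSum 1 (suc s) * v (suc n) - q * uSum 0 (suc s) * v n
    boundaryValue-suc s = begin
      boundaryValue (suc s)                                         ≈⟨ Σ<-head (suc s) _ ⟩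
      eulerian (suc s) 0 * v (k ℕ.+ 0) + Σ< R (suc s) (λ j → eulerian (suc s) (suc j) * v (k ℕ.+ suc j))
        ≈⟨ trans (+-congʳ (trans (*-congʳ (eulerian-at-0 s)) (zeroˡ _))) (+-identityˡ _) ⟩
      Σ< R (suc s) (λ j → eulerian (suc s) (suc j) * v (k ℕ.+ suc j)) ≈⟨ Σ<-cong (suc s) term ⟩
      Σ< R (suc s) (λ j → a j * u (suc j ℕ.+ suc s ℕ.+ 1) * v (suc n) - q * (a j * u (suc j ℕ.+ suc s ℕ.+ 0)) * v n)
        ≈⟨ Σ<-linear₂ (suc s) _ _ q (v (suc n)) (v n) ⟩
      uSum 1 (suc s) * v (suc n) - q * uSum 0 (suc s) * v n         ∎
      where
      k : ℕ
      k = n ℕ.+ suc (suc s)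
      a : ℕ → Carrier
      a j = A (suc s) (suc j)
      vIndex : ∀ n s j → n ℕ.+ suc (suc s) ℕ.+ suc j ≡ suc (suc j ℕ.+ suc s ℕ.+ 0) ℕ.+ n
      vIndex = solve-∀
      uIndex : ∀ s j → suc (suc j ℕ.+ suc s ℕ.+ 0) ≡ suc j ℕ.+ suc s ℕ.+ 1
      uIndex = solve-∀
      term : ∀ j → eulerian (suc s) (suc j) * v (k ℕ.+ suc j)
                   ≈ a j * u (suc j ℕ.+ suc s ℕ.+ 1) * v (suc n) - q * (a j * u (suc j ℕ.+ suc s ℕ.+ 0)) * v n
      term j = begin
        eulerian (suc s) (suc j) * v (k ℕ.+ suc j)
          ≈⟨ *-cong (eulerian≈Eulerian (suc s) (suc j)) (reflexive (≡.cong v (vIndex n s j))) ⟩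
        a j * v (suc K ℕ.+ n)
          ≈⟨ *-congˡ (expand-by-fundamental u-rec u0 u1 v-rec n K) ⟩
        a j * (u (suc K) * v (suc n) - q * u K * v n)
          ≡⟨ ≡.cong (λ i → a j * (u i * v (suc n) - q * u K * v n)) (uIndex s j) ⟩
        a j * (u (suc j ℕ.+ suc s ℕ.+ 1) * v (suc n) - q * u K * v n)
          ≈⟨ solve 6 (λ a x y q z w → a :* (x :* y :- q :* z :* w) := a :* x :* y :- q :* (a :* z) :* w)
                     refl _ _ _ _ _ _ ⟩
        a j * u (suc j ℕ.+ suc s ℕ.+ 1) * v (suc n) - q * (a j * u K) * v n ∎
        where
        K : ℕ
        K = suc j ℕ.+ suc s ℕ.+ 0

    boundarySum : Σ< R (suc m) (λ s → κ s * pow R qinv (suc s) * boundaryValue s)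
                  ≈ nᵐ * qinv * v (suc n) + (inner 1 * v (suc n) - q * inner 0 * v n)
    boundarySum = begin
      Σ< R (suc m) (λ s → coeff s * boundaryValue s)                     ≈⟨ Σ<-head m _ ⟩
      coeff 0 * boundaryValue 0 + Σ< R m (λ s → coeff (suc s) * boundaryValue (suc s))
        ≈⟨ +-cong (*-cong c₀ boundaryValue-zero) (Σ<-cong m (λ s → trans (*-congˡ (boundaryValue-suc s)) (distribute s))) ⟩
      nᵐ * qinv * v (suc n)
        + Σ< R m (λ s → coeff (suc s) * uSum 1 (suc s) * v (suc n) - q * (coeff (suc s) * uSum 0 (suc s)) * v n)
        ≈⟨ +-congˡ (Σ<-linear₂ m _ _ q (v (suc n)) (v n)) ⟩
      nᵐ * qinv * v (suc n) + (inner 1 * v (suc n) - q * inner 0 * v n) ∎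
      where
      coeff : ℕ → Carrier
      coeff s = κ s * pow R qinv (suc s)
      c₀ : coeff 0 ≈ nᵐ * qinv
      c₀ = *-cong (trans (*-congʳ (+-identityʳ 1#)) (*-identityˡ nᵐ)) (*-identityʳ qinv)
      distribute : ∀ s → coeff (suc s) * (uSum 1 (suc s) * v (suc n) - q * uSum 0 (suc s) * v n)
                         ≈ coeff (suc s) * uSum 1 (suc s) * v (suc n) - q * (coeff (suc s) * uSum 0 (suc s)) * v n
      distribute s = solve 6 (λ c a x q b y → c :* (a :* x :- q :* b :* y) := c :* a :* x :- q :* (c :* b) :* y)
                             refl _ _ _ _ _ _

    eulerianSum : eval (suc m) (eulerian m) (suc m) ≈ Σ0 R m (λ j → A m j * v (j ℕ.+ m ℕ.+ 1))
    eulerianSum = Σ<-cong (suc m) (λ J → *-cong (eulerian≈Eulerian m J) (reflexive (≡.cong v (index m J))))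
      where
      index : ∀ m J → suc m ℕ.+ J ≡ J ℕ.+ m ℕ.+ 1
      index = solve-∀

    scaledPowerSum : Σ< R (suc n) (λ j → pow R (ι R j) m * v j)
      ≈ pow R qinv (suc m) * eval (suc m) (eulerian m) (suc m)
        - Σ< R (suc m) (λ s → κ s * pow R qinv (suc s) * boundaryValue s) + nᵐ * v n
    scaledPowerSum = begin
      S                                    ≈⟨ trans (*-congʳ (pow-inverse qq (suc m))) (*-identityˡ S) ⟨
      (Qinv * Q) * S                       ≈⟨ *-assoc _ _ _ ⟩
      Qinv * (Q * S)                       ≈⟨ *-congˡ powerSum-eval ⟩
      Qinv * (E - (Σ< R (suc m) (λ s → κ s * (pow R q (m ℕ.∸ s) * boundaryValue s)) - nᵐ * (Q * v n)))
        ≈⟨ solve 6 (λ Qi E T N Q x → Qi :* (E :- (T :- N :* (Q :* x))) := Qi :* E :- Qi :* T :+ N :* (Qi :* Q) :* x)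
                   refl _ _ _ _ _ _ ⟩
      Qinv * E - Qinv * Σ< R (suc m) (λ s → κ s * (pow R q (m ℕ.∸ s) * boundaryValue s)) + nᵐ * (Qinv * Q) * v n
        ≈⟨ +-cong (+-congˡ (-‿cong (trans (Σ<-distribˡ (suc m) Qinv _) (Σ<-cong-< (suc m) rescale))))
                  (*-congʳ (trans (*-congˡ (pow-inverse qq (suc m))) (*-identityʳ nᵐ))) ⟩
      Qinv * E - Σ< R (suc m) (λ s → κ s * pow R qinv (suc s) * boundaryValue s) + nᵐ * v n ∎
      where
      S : Carrier
      S = Σ< R (suc n) (λ j → pow R (ι R j) m * v j)
      E : Carrier
      E = eval (suc m) (eulerian m) (suc m)
      Q : Carrier
      Q = pow R q (suc m)
      Qinv : Carrier
      Qinv = pow R qinv (suc m)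
      rescale : ∀ s → s < suc m →
                Qinv * (κ s * (pow R q (m ℕ.∸ s) * boundaryValue s)) ≈ κ s * pow R qinv (suc s) * boundaryValue s
      rescale s s<1+m = begin
        Qinv * (κ s * (qᵈ * e))
          ≈⟨ *-congʳ (trans (reflexive (≡.cong (pow R qinv) split)) (pow-+ qinv (m ℕ.∸ s) (suc s))) ⟩
        (qinvᵈ * pow R qinv (suc s)) * (κ s * (qᵈ * e))
          ≈⟨ solve 5 (λ a b k c e → (a :* b) :* (k :* (c :* e)) := k :* b :* e :* (a :* c)) refl _ _ _ _ _ ⟩
        κ s * pow R qinv (suc s) * e * (qinvᵈ * qᵈ)
          ≈⟨ trans (*-congˡ (pow-inverse qq (m ℕ.∸ s))) (*-identityʳ _) ⟩
        κ s * pow R qinv (suc s) * e              ∎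
        where
        qᵈ : Carrier
        qᵈ = pow R q (m ℕ.∸ s)
        qinvᵈ : Carrier
        qinvᵈ = pow R qinv (m ℕ.∸ s)
        e : Carrier
        e = boundaryValue s
        split : suc m ≡ m ℕ.∸ s ℕ.+ suc s
        split = ≡.sym (≡.trans (ℕₚ.+-suc (m ℕ.∸ s) s) (≡.cong suc (ℕₚ.m∸n+n≡m (s≤s⁻¹ s<1+m))))

    closedForm : Σ1 R n (λ k → pow R (ι R k) m * v k)
      ≈ (- (v 0 * δ0 R m)) + (nᵐ + q * inner 0) * v n - (nᵐ * qinv + inner 1) * v (suc n)
        + pow R qinv (suc m) * Σ0 R m (λ j → A m j * v (j ℕ.+ m ℕ.+ 1))
    closedForm = begin
      T                                       ≈⟨ solve 2 (λ p t → (p :+ t) :- p := t) refl p₀ T ⟨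
      (p₀ + T) - p₀                           ≈⟨ +-cong (Σ<-head n _) (-‿cong (*-congʳ (sym (pow-0# m)))) ⟨
      Σ< R (suc n) (λ j → pow R (ι R j) m * v j) - δ0 R m * v 0
        ≈⟨ +-congʳ (trans scaledPowerSum (+-congʳ (+-cong (*-congˡ eulerianSum) (-‿cong boundarySum)))) ⟩
      (Qinv * E′ - (nᵐ * qinv * v (suc n) + (inner 1 * v (suc n) - q * inner 0 * v n)) + nᵐ * v n) - δ0 R m * v 0
        ≈⟨ solve 11 (λ Qi E N qi x i₁ q i₀ y d y₀ →
                       (Qi :* E :- (N :* qi :* x :+ (i₁ :* x :- q :* i₀ :* y)) :+ N :* y) :- d :* y₀
                       := (:- (y₀ :* d)) :+ (N :+ q :* i₀) :* y :- (N :* qi :+ i₁) :* x :+ Qi :* E)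
                 refl Qinv E′ nᵐ qinv (v (suc n)) (inner 1) q (inner 0) (v n) (δ0 R m) (v 0) ⟩
      (- (v 0 * δ0 R m)) + (nᵐ + q * inner 0) * v n - (nᵐ * qinv + inner 1) * v (suc n) + Qinv * E′ ∎
      where
      T : Carrier
      T = Σ1 R n (λ k → pow R (ι R k) m * v k)
      p₀ : Carrier
      p₀ = pow R (ι R 0) m * v 0
      Qinv : Carrier
      Qinv = pow R qinv (suc m)
      E′ : Carrier
      E′ = Σ0 R m (λ j → A m j * v (j ℕ.+ m ℕ.+ 1))

mainTheorem15 : ∀ {c ℓ : Level} (R : CommutativeRing c ℓ) →
  let open CommutativeRing R in
  (a b q qinv : Carrier) → q * qinv ≈ 1# →
  (m n : ℕ) (r : ℤ) →
  let w : ℤ → Carrier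
      w j = wStar R q qinv a b j
      u : ℤ → Carrier
      u j = uSeq R q qinv j
      N : ℕ → Carrier
      N = ι R
      A : ℕ → ℕ → Carrier
      A i j = ιℤ R (Eulerian i j)
      _^_ : Carrier → ℕ → Carrier
      _^_ = pow R
      inner : ℕ → Carrier
      inner k = Σ1 R m (λ s → N (m C s) * (N n ^ (m Data.Nat.∸ s)) * (qinv ^ suc s)
                   * Σ1 R s (λ j → A s j * u (+ (j Data.Nat.+ s Data.Nat.+ k))))
  in Σ1 R n (λ k → (N k ^ m) * w (+ k Data.Integer.+ r))
     ≈ (- (w r * δ0 R m))
       + ((N n ^ m) + q * inner 0) * w (+ n Data.Integer.+ r)
       - ((N n ^ m) * qinv + inner 1) * w (+ n Data.Integer.+ r Data.Integer.+ + 1)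
       + (qinv ^ suc m) * Σ0 R m (λ j → A m j * w (+ (j Data.Nat.+ m Data.Nat.+ 1) Data.Integer.+ r))
mainTheorem15 R a b q qinv qq m n r =
  trans (ClosedForm.closedForm q qinv qq v u (Horadam.shifted-recurrence q qinv a b qq r) u-rec refl refl m n)
        (+-congʳ (+-cong (+-congʳ (-‿cong (*-congʳ v₀≈w))) (-‿cong (*-congˡ v₁≈w))))
  where
  open CommutativeRing R
  open HoradamPowerSums R

  w : ℤ → Carrier
  w = wStar R q qinv a b

  v u : ℕ → Carrier
  v k = w (+ k ℤ.+ r)
  u K = uSeq R q qinv (+ K)

  u-rec : SatisfiesRecurrence q u
  u-rec K = Horadam.wStar-recurrence q qinv 0# 1# qq (+ K)

  v₀≈w : v 0 ≈ w r
  v₀≈w = reflexive (≡.cong w (ℤₚ.+-identityˡ r))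

  v₁≈w : v (suc n) ≈ w (+ n ℤ.+ r ℤ.+ + 1)
  v₁≈w = reflexive (≡.cong w (≡.trans (ℤₚ.+-assoc (+ 1) (+ n) r) (ℤₚ.+-comm (+ 1) (+ n ℤ.+ r))))
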